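{- For $n\ge 0$ let $b_n$ be the number of partially directed walks of length $n$ that lie in the quadrant $\{(X,Y)\in\mathbb{Z}^2 : X\ge 0,\ Y\ge 0\}$ and whose last vertex lies on the line $Y=0$. Then \[ \lim_{n\to\infty} b_n^{1/n} = 1+\sqrt{2}. \]
   Context: A partially directed walk of length $n$ on the square lattice is a sequence of lattice points $v_0=(0,0),v_1,\dots,v_n\in\mathbb{Z}^2$ such that each step $v_i-v_{i-1}$ is one of $(1,0)$ (east), $(0,1)$ (north), $(0,-1)$ (south), and no north step is immediately followed by a south step or vice versa (equivalently, the walk is self-avoiding). A walk lies in a set $S$ if all its vertices lie in $S$. -}

module Defs where

open import Data.Nat as ℕ using (ℕ; zero; suc)
open import Data.Integer as ℤ using (ℤ; 0ℤ; 1ℤ; -1ℤ)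
open import Data.Integer.Properties as ℤP using ()
open import Data.Sum using (_⊎_)
open import Data.Product using (_×_; _,_; proj₁; proj₂)
open import Data.Product.Properties using (≡-dec)
open import Data.List using (List; []; _∷_; length; filter; concatMap)
open import Data.List.Relation.Unary.All using (All; all?)
open import Data.List.Relation.Unary.Linked using (Linked; linked?)
open import Data.Rational as ℚ using (ℚ; 1ℚ; _*_)
open import Relation.Nullary using (Dec; yes; no; ¬_)
open import Relation.Nullary.Decidable using (_×-dec_; ¬?)
open import Relation.Binary.PropositionalEquality using (_≡_)

data Step : Set where
  E N S : Step

Point : Set
Point = ℤ × ℤ

move : Point → Step → Point
move (x , y) E = (x ℤ.+ 1ℤ , y)
move (x , y) N = (x , y ℤ.+ 1ℤ)
move (x , y) S = (x , y ℤ.+ -1ℤ)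

vertices : Point → List Step → List Point
vertices p []      = p ∷ []
vertices p (s ∷ w) = p ∷ vertices (move p s) w

endpoint : Point → List Step → Point
endpoint p []      = p
endpoint p (s ∷ w) = endpoint (move p s) w

origin : Point
origin = (0ℤ , 0ℤ)

data Opposite : Step → Step → Set where
  NS : Opposite N S
  SN : Opposite S N

opposite? : (a b : Step) → Dec (Opposite a b)
opposite? E E = no λ ()
opposite? E N = no λ ()
opposite? E S = no λ ()
opposite? N E = no λ ()
opposite? N N = no λ ()
opposite? N S = yes NS
opposite? S E = no λ ()
opposite? S N = yes SN
opposite? S S = no λ ()

NoReversal : List Step → Set
NoReversal = Linked (λ a b → ¬ Opposite a b)

InQuadrant : Point → Set
InQuadrant (x , y) = (0ℤ ℤ.≤ x) × (0ℤ ℤ.≤ y)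

Counted : List Step → Set
Counted w = NoReversal w × All InQuadrant (vertices origin w) × (proj₂ (endpoint origin w) ≡ 0ℤ)

counted? : (w : List Step) → Dec (Counted w)
counted? w =
  linked? (λ a b → ¬? (opposite? a b)) w
  ×-dec all? (λ { (x , y) → (0ℤ ℤ.≤? x) ×-dec (0ℤ ℤ.≤? y) }) (vertices origin w)
  ×-dec (proj₂ (endpoint origin w) ℤP.≟ 0ℤ)

allSteps : ℕ → List (List Step)
allSteps zero    = [] ∷ []
allSteps (suc n) = concatMap (λ w → (E ∷ w) ∷ (N ∷ w) ∷ (S ∷ w) ∷ []) (allSteps n)

b : ℕ → ℕ
b n = length (filter counted? (allSteps n))

_^ℚ_ : ℚ → ℕ → ℚ
p ^ℚ zero  = 1ℚ
p ^ℚ suc n = p * (p ^ℚ n)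

-- Rational comparisons with 1 + √2 (both sides handled without reals).
-- p < 1 + √2  ⇔  p < 1  or  (p - 1)² < 2
BelowL : ℚ → Set
BelowL p = (p ℚ.< 1ℚ) ⊎ (((p ℚ.- 1ℚ) * (p ℚ.- 1ℚ)) ℚ.< (1ℚ ℚ.+ 1ℚ))

-- 1 + √2 < q  ⇔  1 < q  and  2 < (q - 1)²
AboveL : ℚ → Set
AboveL q = (1ℚ ℚ.< q) × ((1ℚ ℚ.+ 1ℚ) ℚ.< ((q ℚ.- 1ℚ) * (q ℚ.- 1ℚ)))

ℕtoℚ : ℕ → ℚ
ℕtoℚ n = ℚ.normalize n 1

-- Counted walks are partially directed walks, whose numbers (split by whether the previous step was
-- east or vertical) satisfy x' = x + 2y, y' = x + y, a recurrence with growth rate 1 + √2; comparing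
-- with the vector (s, 1) for rational s slightly above or below √2 bounds them. For the lower bound,
-- fix L and by pigeonhole a height e reached from height 2L by at least a 1/(3L+1) share of the walks
-- of length L; concatenating such walks with mirror images of them gives walks that stay in the
-- quadrant and return to the axis, and for large L their number still grows faster than any given
-- ratio below 1 + √2.
module Submission where

open import Defs

module Counting where

  open import Data.Bool using (Bool; true; false; _∧_; T)
  open import Data.Bool.Properties using (∧-conicalˡ; ∧-conicalʳ; ∧-identityʳ)
  open import Data.Empty using (⊥-elim)
  open import Data.Integer as ℤ using (0ℤ)
  import Data.Integer.Properties as ℤ
  open import Data.List using (List; []; _∷_; _++_; length; map; replicate; filter; concatMap)
  open import Data.List.Properties using (++-assoc; length-++; length-map; length-replicate)
  open import Data.List.Relation.Unary.All using (All; []; _∷_)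
  open import Data.List.Relation.Unary.Linked using ([]; [-]; _∷_)
  open import Data.Nat
  open import Data.Nat.DivMod using (m≡m%n+[m/n]*n; m%n<n)
  open import Data.Nat.ListAction using (sum)
  open import Data.Nat.Properties
  open import Data.Nat.Tactic.RingSolver using (solve-∀)
  open import Data.Product using (∃; _×_; _,_; proj₁; proj₂; map₁)
  open import Data.Sum using (inj₁; inj₂)
  open import Data.Unit using (⊤; tt)
  open import Function using (_∘_)
  open import Relation.Binary.PropositionalEquality
  open import Relation.Nullary using (Dec; does; yes; no; ¬_)
  open import Relation.Nullary.Decidable using (dec-true)
  open import Relation.Unary using (Decidable)

  *-self-cancel-≤ : ∀ {m n} → m * m ≤ n * n → m ≤ n
  *-self-cancel-≤ m²≤n² = ≮⇒≥ (λ n<m → <⇒≱ (*-mono-< n<m n<m) m²≤n²)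

  ^-distribʳ-* : ∀ m n k → (m * n) ^ k ≡ m ^ k * n ^ k
  ^-distribʳ-* m n zero    = refl
  ^-distribʳ-* m n (suc k) = trans (cong (m * n *_) (^-distribʳ-* m n k)) (shuffle m n (m ^ k) (n ^ k))
    where
    shuffle : ∀ m n p r → m * n * (p * r) ≡ m * p * (n * r)
    shuffle = solve-∀

  bernoulli : ∀ {x y} → y < x → ∀ n → n * y ^ n ≤ y * x ^ n
  bernoulli y<x zero = z≤n
  bernoulli {x} {y} y<x (suc n) = begin
      suc n * (y * y ^ n)
    ≡⟨ e₁ n y (y ^ n) ⟩
      y * (n * y ^ n) + y * y ^ n
    ≤⟨ +-mono-≤ (*-monoʳ-≤ y (bernoulli y<x n)) (*-monoʳ-≤ y (^-monoˡ-≤ n (<⇒≤ y<x))) ⟩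
      y * (y * x ^ n) + y * x ^ n
    ≡⟨ e₂ y (x ^ n) ⟩
      y * (suc y * x ^ n)
    ≤⟨ *-monoʳ-≤ y (*-monoˡ-≤ (x ^ n) y<x) ⟩
      y * (x * x ^ n)
    ∎
    where
    open ≤-Reasoning
    e₁ : ∀ n y p → suc n * (y * p) ≡ y * (n * p) + y * p
    e₁ = solve-∀
    e₂ : ∀ y p → y * (y * p) + y * p ≡ y * (suc y * p)
    e₂ = solve-∀

  -- Split q = M + j with j ≥ M and apply Bernoulli to both factors y ^ M and y ^ j.
  eventually-C*q*y^q<x^q : ∀ C {x y} → y < x → ∃ λ Q → ∀ q → Q ≤ q → C * q * y ^ q < x ^ q
  eventually-C*q*y^q<x^q C {x} {y} y<x = M + M , bound
    where
    M = suc (2 * C * y * y)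
    instance
      x≢0 : NonZero x
      x≢0 = >-nonZero (≤-<-trans z≤n y<x)
    split : ∀ j → M ≤ j → C * (M + j) * y ^ (M + j) < x ^ (M + j)
    split j M≤j = *-cancelˡ-< M _ _ (begin-strict
        M * (C * (M + j) * y ^ (M + j))
      ≤⟨ *-monoʳ-≤ M (*-monoˡ-≤ (y ^ (M + j)) (*-monoʳ-≤ C (+-monoˡ-≤ j M≤j))) ⟩
        M * (C * (j + j) * y ^ (M + j))
      ≡⟨ cong (λ p → M * (C * (j + j) * p)) (^-distribˡ-+-* y M j) ⟩
        M * (C * (j + j) * (y ^ M * y ^ j))
      ≡⟨ e₁ M C j (y ^ M) (y ^ j) ⟩
        2 * C * ((M * y ^ M) * (j * y ^ j))
      ≤⟨ *-monoʳ-≤ (2 * C) (*-mono-≤ (bernoulli y<x M) (bernoulli y<x j)) ⟩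
        2 * C * ((y * x ^ M) * (y * x ^ j))
      ≡⟨ e₂ C y (x ^ M) (x ^ j) ⟩
        2 * C * y * y * (x ^ M * x ^ j)
      ≡⟨ cong (2 * C * y * y *_) (^-distribˡ-+-* x M j) ⟨
        2 * C * y * y * x ^ (M + j)
      <⟨ *-monoˡ-< (x ^ (M + j)) {{m^n≢0 x (M + j)}} (n<1+n (2 * C * y * y)) ⟩
        M * x ^ (M + j)
      ∎)
      where
      open ≤-Reasoning
      e₁ : ∀ M C j p r → M * (C * (j + j) * (p * r)) ≡ 2 * C * ((M * p) * (j * r))
      e₁ = solve-∀
      e₂ : ∀ C y p r → 2 * C * ((y * p) * (y * r)) ≡ 2 * C * y * y * (p * r)
      e₂ = solve-∀
    bound : ∀ q → M + M ≤ q → C * q * y ^ q < x ^ q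
    bound q 2M≤q = subst (λ r → C * r * y ^ r < x ^ r) (m+[n∸m]≡n M≤q)
      (split (q ∸ M) (+-cancelˡ-≤ M M (q ∸ M) (subst (M + M ≤_) (sym (m+[n∸m]≡n M≤q)) 2M≤q)))
      where
      M≤q = ≤-trans (m≤m+n M M) 2M≤q

  eventually-C*y^q<x^q : ∀ C {x y} → y < x → ∃ λ Q → ∀ q → Q ≤ q → C * y ^ q < x ^ q
  eventually-C*y^q<x^q C y<x with eventually-C*q*y^q<x^q C y<x
  ... | Q , bound = suc Q , λ { q@(suc _) Q<q →
    ≤-<-trans (*-monoˡ-≤ _ (m≤m*n C q)) (bound q (<⇒≤ Q<q)) }

  progression-cover : ∀ k .{{_ : NonZero k}} n₀ Q n → n₀ + k * Q ≤ n →
    ∃ λ pad → ∃ λ q → pad < k × Q ≤ q × n ≡ pad + n₀ + k * q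
  progression-cover k n₀ Q n n≥ = j % k , j / k , m%n<n j k , Q≤q , n≡
    where
    j = n ∸ n₀
    n₀+j≡n : n₀ + j ≡ n
    n₀+j≡n = m+[n∸m]≡n (≤-trans (m≤m+n n₀ (k * Q)) n≥)
    n≡ : n ≡ j % k + n₀ + k * (j / k)
    n≡ = trans (sym n₀+j≡n) (trans (cong (n₀ +_) (m≡m%n+[m/n]*n j k)) (rearrange n₀ (j % k) (j / k) k))
      where
      rearrange : ∀ n₀ p q k → n₀ + (p + q * k) ≡ p + n₀ + k * q
      rearrange = solve-∀
    Q≤q : Q ≤ j / k
    Q≤q = s≤s⁻¹ (*-cancelˡ-< k Q (suc (j / k)) (begin-strict
        k * Q
      ≤⟨ +-cancelˡ-≤ n₀ (k * Q) j (subst (n₀ + k * Q ≤_) (sym n₀+j≡n) n≥) ⟩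
        j
      ≡⟨ m≡m%n+[m/n]*n j k ⟩
        j % k + j / k * k
      <⟨ +-monoˡ-< (j / k * k) (m%n<n j k) ⟩
        k + j / k * k
      ≡⟨ suc-times k (j / k) ⟩
        k * suc (j / k)
      ∎))
      where
      open ≤-Reasoning
      suc-times : ∀ k q → k + q * k ≡ k * suc q
      suc-times = solve-∀

  -- With k = 2t + 1, the ratio g / h = t / d + 1 / (d k) exceeds t / d while g² ≤ 2 h² still holds.
  below-√2 : ∀ d t → 1 ≤ d → t * t < 2 * d * d →
    ∃ λ g → ∃ λ h → 1 ≤ g × g * g ≤ 2 * h * h × (d + t) * h < (g + h) * d
  below-√2 d t 1≤d t²<2d² = g , h , m≤n+m 1 (t * k) , g²≤2h² , Y<X
    where
    k = 2 * t + 1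
    g = t * k + 1
    h = d * k
    g²≤2h² : g * g ≤ 2 * h * h
    g²≤2h² = begin
        g * g
      ≡⟨ e₁ t k ⟩
        t * t * (k * k) + (2 * t * k + 1)
      ≤⟨ +-monoʳ-≤ (t * t * (k * k))
           (subst (2 * t * k + 1 ≤_) (sym (e₂ t)) (+-monoʳ-≤ (2 * t * k) (m≤n+m 1 (2 * t)))) ⟩
        t * t * (k * k) + k * k
      ≡⟨ e₃ (t * t) (k * k) ⟩
        suc (t * t) * (k * k)
      ≤⟨ *-monoˡ-≤ (k * k) t²<2d² ⟩
        2 * d * d * (k * k)
      ≡⟨ e₄ d k ⟩
        2 * h * h
      ∎
      where
      open ≤-Reasoning
      e₁ : ∀ t k → (t * k + 1) * (t * k + 1) ≡ t * t * (k * k) + (2 * t * k + 1)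
      e₁ = solve-∀
      e₂ : ∀ t → (2 * t + 1) * (2 * t + 1) ≡ 2 * t * (2 * t + 1) + (2 * t + 1)
      e₂ = solve-∀
      e₃ : ∀ x y → x * y + y ≡ suc x * y
      e₃ = solve-∀
      e₄ : ∀ d k → 2 * d * d * (k * k) ≡ 2 * (d * k) * (d * k)
      e₄ = solve-∀
    Y<X : (d + t) * h < (g + h) * d
    Y<X = subst ((d + t) * h <_) (sym (gap d t k)) (subst (_≤ (d + t) * h + d) (+-comm _ 1) (+-monoʳ-≤ _ 1≤d))
      where
      gap : ∀ d t k → (t * k + 1 + d * k) * d ≡ (d + t) * (d * k) + d
      gap = solve-∀

  -- g / h = (h₀ / e + 2 e / h₀) / 2 (a Newton step for √2 from h₀ / e) lies in [√2, h₀ / e).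
  above-√2 : ∀ e h₀ → 1 ≤ e → 2 * e * e < h₀ * h₀ →
    ∃ λ g → ∃ λ h → 1 ≤ h × 2 * h * h ≤ g * g × (g + h) * e < (e + h₀) * h
  above-√2 e h₀ 1≤e 2e²<h₀² = g , h , 1≤h , 2h²≤g² , Y<X
    where
    t = h₀ * h₀ ∸ 2 * e * e
    h₀²≡ : h₀ * h₀ ≡ 2 * e * e + t
    h₀²≡ = sym (m+[n∸m]≡n (<⇒≤ 2e²<h₀²))
    1≤t : 1 ≤ t
    1≤t = +-cancelˡ-≤ (2 * e * e) 1 t
      (subst (2 * e * e + 1 ≤_) h₀²≡ (subst (_≤ h₀ * h₀) (+-comm 1 _) 2e²<h₀²))
    1≤h₀ : 1 ≤ h₀
    1≤h₀ = n≢0⇒n>0 (λ h₀≡0 → <⇒≱ (subst (λ s → 2 * e * e < s * s) h₀≡0 2e²<h₀²) z≤n)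
    g = h₀ * h₀ + 2 * e * e
    h = 2 * h₀ * e
    1≤h : 1 ≤ h
    1≤h = *-mono-≤ (*-mono-≤ (s≤s (z≤n {1})) 1≤h₀) 1≤e
    2h²≤g² : 2 * h * h ≤ g * g
    2h²≤g² = subst (2 * h * h ≤_) (sym g²≡) (m≤m+n _ _)
      where
      g²≡ : g * g ≡ 2 * h * h + t * t
      g²≡ = begin
          g * g
        ≡⟨ cong (λ s → (s + 2 * e * e) * (s + 2 * e * e)) h₀²≡ ⟩
          (2 * e * e + t + 2 * e * e) * (2 * e * e + t + 2 * e * e)
        ≡⟨ e₁ e t ⟩
          8 * (2 * e * e + t) * (e * e) + t * t
        ≡⟨ cong (λ s → 8 * s * (e * e) + t * t) h₀²≡ ⟨
          8 * (h₀ * h₀) * (e * e) + t * t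
        ≡⟨ cong (_+ t * t) (e₂ h₀ e) ⟩
          2 * h * h + t * t
        ∎
        where
        open ≡-Reasoning
        e₁ : ∀ e t → (2 * e * e + t + 2 * e * e) * (2 * e * e + t + 2 * e * e) ≡ 8 * (2 * e * e + t) * (e * e) + t * t
        e₁ = solve-∀
        e₂ : ∀ h₀ e → 8 * (h₀ * h₀) * (e * e) ≡ 2 * (2 * h₀ * e) * (2 * h₀ * e)
        e₂ = solve-∀
    Y<X : (g + h) * e < (e + h₀) * h
    Y<X = subst ((g + h) * e <_) (sym X≡)
      (subst (_≤ (g + h) * e + e * t) (+-comm _ 1) (+-monoʳ-≤ _ (*-mono-≤ 1≤e 1≤t)))
      where
      X≡ : (e + h₀) * h ≡ (g + h) * e + e * t
      X≡ = begin
          (e + h₀) * (2 * h₀ * e)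
        ≡⟨ e₁ e h₀ ⟩
          2 * h₀ * e * e + 2 * e * (h₀ * h₀)
        ≡⟨ cong (λ s → 2 * h₀ * e * e + 2 * e * s) h₀²≡ ⟩
          2 * h₀ * e * e + 2 * e * (2 * e * e + t)
        ≡⟨ e₂ e h₀ t ⟩
          (2 * e * e + t + 2 * e * e + 2 * h₀ * e) * e + e * t
        ≡⟨ cong (λ s → (s + 2 * e * e + 2 * h₀ * e) * e + e * t) h₀²≡ ⟨
          (g + h) * e + e * t
        ∎
        where
        open ≡-Reasoning
        e₁ : ∀ e h₀ → (e + h₀) * (2 * h₀ * e) ≡ 2 * h₀ * e * e + 2 * e * (h₀ * h₀)
        e₁ = solve-∀
        e₂ : ∀ e h₀ t →
          2 * h₀ * e * e + 2 * e * (2 * e * e + t) ≡ (2 * e * e + t + 2 * e * e + 2 * h₀ * e) * e + e * t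
        e₂ = solve-∀

  sumBelow : ℕ → (ℕ → ℕ) → ℕ
  sumBelow zero    f = 0
  sumBelow (suc K) f = sumBelow K f + f K

  term≤sumBelow : ∀ K f {i} → i < K → f i ≤ sumBelow K f
  term≤sumBelow (suc K) f {i} (s≤s i≤K) with m≤n⇒m<n∨m≡n i≤K
  ... | inj₁ i<K  = ≤-trans (term≤sumBelow K f i<K) (m≤m+n _ _)
  ... | inj₂ refl = m≤n+m _ _

  pigeonhole : ∀ K f → ∃ λ i → sumBelow K f ≤ K * f i
  pigeonhole zero    f = 0 , z≤n
  pigeonhole (suc K) f with pigeonhole K f
  ... | i , Σ≤Kfi with f i ≤? f K
  ...   | yes fi≤fK = K ,
    ≤-trans (+-monoˡ-≤ (f K) (≤-trans Σ≤Kfi (*-monoʳ-≤ K fi≤fK))) (≤-reflexive (+-comm _ (f K)))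
  ...   | no  fi≰fK = i ,
    ≤-trans (+-monoʳ-≤ _ (<⇒≤ (≰⇒> fi≰fK)))
      (≤-trans (+-monoˡ-≤ (f i) Σ≤Kfi) (≤-reflexive (+-comm _ (f i))))

  ≡ᵇ-refl : ∀ m → (m ≡ᵇ m) ≡ true
  ≡ᵇ-refl zero    = refl
  ≡ᵇ-refl (suc m) = ≡ᵇ-refl m

  ≡ᵇ-true⇒≡ : ∀ m n → (m ≡ᵇ n) ≡ true → m ≡ n
  ≡ᵇ-true⇒≡ m n eq = ≡ᵇ⇒≡ m n (subst T (sym eq) tt)

  Word : Set
  Word = List Step

  𝟙 : Bool → ℕ
  𝟙 true  = 1
  𝟙 false = 0

  𝟙-does-≤ : ∀ {P : Set} (P? : Dec P) {c} → (P → c ≡ true) → 𝟙 (does P?) ≤ 𝟙 c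
  𝟙-does-≤ (yes p) P⇒c = ≤-reflexive (cong 𝟙 (sym (P⇒c p)))
  𝟙-does-≤ (no _)  _   = z≤n

  𝟙*[p*𝟙]≤ : ∀ x y {P Q} → (x ≡ true → y ≡ true → P ≤ Q) → 𝟙 x * (P * 𝟙 y) ≤ Q
  𝟙*[p*𝟙]≤ false _     _ = z≤n
  𝟙*[p*𝟙]≤ true  false {P} _ = ≤-trans (≤-reflexive (trans (+-identityʳ (P * 0)) (*-zeroʳ P))) z≤n
  𝟙*[p*𝟙]≤ true  true  {P} P≤Q =
    ≤-trans (≤-reflexive (trans (+-identityʳ (P * 1)) (*-identityʳ P))) (P≤Q refl refl)

  sumWords : ℕ → (Word → ℕ) → ℕ
  sumWords zero    f = f []
  sumWords (suc n) f = sumWords n (f ∘ (E ∷_)) + sumWords n (f ∘ (N ∷_)) + sumWords n (f ∘ (S ∷_))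

  sumWords-cong : ∀ n {f g : Word → ℕ} → (∀ w → f w ≡ g w) → sumWords n f ≡ sumWords n g
  sumWords-cong zero    f≡g = f≡g []
  sumWords-cong (suc n) f≡g = cong₂ _+_
    (cong₂ _+_ (sumWords-cong n (f≡g ∘ (E ∷_))) (sumWords-cong n (f≡g ∘ (N ∷_))))
    (sumWords-cong n (f≡g ∘ (S ∷_)))

  sumWords-mono : ∀ n {f g : Word → ℕ} → (∀ w → length w ≡ n → f w ≤ g w) → sumWords n f ≤ sumWords n g
  sumWords-mono zero    f≤g = f≤g [] refl
  sumWords-mono (suc n) f≤g = +-mono-≤
    (+-mono-≤ (sumWords-mono n (λ w → f≤g (E ∷ w) ∘ cong suc))
              (sumWords-mono n (λ w → f≤g (N ∷ w) ∘ cong suc)))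
    (sumWords-mono n (λ w → f≤g (S ∷ w) ∘ cong suc))

  sumWords-+ : ∀ n (f g : Word → ℕ) → sumWords n (λ w → f w + g w) ≡ sumWords n f + sumWords n g
  sumWords-+ zero    f g = refl
  sumWords-+ (suc n) f g = begin
      sumWords n (λ w → f (E ∷ w) + g (E ∷ w)) + sumWords n (λ w → f (N ∷ w) + g (N ∷ w))
        + sumWords n (λ w → f (S ∷ w) + g (S ∷ w))
    ≡⟨ cong₂ _+_ (cong₂ _+_ (sumWords-+ n _ _) (sumWords-+ n _ _)) (sumWords-+ n _ _) ⟩
      (fE + gE) + (fN + gN) + (fS + gS)
    ≡⟨ regroup fE fN fS gE gN gS ⟩
      (fE + fN + fS) + (gE + gN + gS)
    ∎
    where
    open ≡-Reasoning
    fE = sumWords n (f ∘ (E ∷_))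
    fN = sumWords n (f ∘ (N ∷_))
    fS = sumWords n (f ∘ (S ∷_))
    gE = sumWords n (g ∘ (E ∷_))
    gN = sumWords n (g ∘ (N ∷_))
    gS = sumWords n (g ∘ (S ∷_))
    regroup : ∀ a b c d e f → (a + d) + (b + e) + (c + f) ≡ (a + b + c) + (d + e + f)
    regroup = solve-∀

  sumWords-*ˡ : ∀ n c (f : Word → ℕ) → sumWords n (λ w → c * f w) ≡ c * sumWords n f
  sumWords-*ˡ zero    c f = refl
  sumWords-*ˡ (suc n) c f = begin
      sumWords n (λ w → c * f (E ∷ w)) + sumWords n (λ w → c * f (N ∷ w)) + sumWords n (λ w → c * f (S ∷ w))
    ≡⟨ cong₂ _+_ (cong₂ _+_ (sumWords-*ˡ n c _) (sumWords-*ˡ n c _)) (sumWords-*ˡ n c _) ⟩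
      c * sumWords n (f ∘ (E ∷_)) + c * sumWords n (f ∘ (N ∷_)) + c * sumWords n (f ∘ (S ∷_))
    ≡⟨ factor c _ _ _ ⟩
      c * sumWords (suc n) f
    ∎
    where
    open ≡-Reasoning
    factor : ∀ c x y z → c * x + c * y + c * z ≡ c * (x + y + z)
    factor = solve-∀

  sumWords-product : ∀ m n (f g : Word → ℕ) →
    sumWords m (λ u → sumWords n (λ v → f u * g v)) ≡ sumWords m f * sumWords n g
  sumWords-product m n f g = begin
      sumWords m (λ u → sumWords n (λ v → f u * g v))
    ≡⟨ sumWords-cong m (λ u → sumWords-*ˡ n (f u) g) ⟩
      sumWords m (λ u → f u * sumWords n g)
    ≡⟨ sumWords-cong m (λ u → *-comm (f u) _) ⟩
      sumWords m (λ u → sumWords n g * f u)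
    ≡⟨ sumWords-*ˡ m (sumWords n g) f ⟩
      sumWords n g * sumWords m f
    ≡⟨ *-comm _ (sumWords m f) ⟩
      sumWords m f * sumWords n g
    ∎
    where open ≡-Reasoning

  sumWords-zero : ∀ n → sumWords n (λ _ → 0) ≡ 0
  sumWords-zero zero    = refl
  sumWords-zero (suc n) rewrite sumWords-zero n = refl

  sumWords-sumBelow : ∀ n K (g : ℕ → Word → ℕ) →
    sumWords n (λ w → sumBelow K (λ i → g i w)) ≡ sumBelow K (λ i → sumWords n (g i))
  sumWords-sumBelow n zero    g = sumWords-zero n
  sumWords-sumBelow n (suc K) g =
    trans (sumWords-+ n _ (g K)) (cong (_+ sumWords n (g K)) (sumWords-sumBelow n K g))

  sumWords-++ : ∀ m n (f : Word → ℕ) → sumWords (m + n) f ≡ sumWords m (λ u → sumWords n (λ v → f (u ++ v)))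
  sumWords-++ zero    n f = refl
  sumWords-++ (suc m) n f = cong₂ _+_ (cong₂ _+_ (sumWords-++ m n _) (sumWords-++ m n _)) (sumWords-++ m n _)

  sumWords-E∷-≤ : ∀ n (f : Word → ℕ) → sumWords n (f ∘ (E ∷_)) ≤ sumWords (suc n) f
  sumWords-E∷-≤ n f = ≤-trans (m≤m+n _ _) (m≤m+n _ _)

  sumWords-E∷-E∷ : ∀ m n (g : Word → ℕ) →
    sumWords m (λ u → sumWords n (λ v → g (E ∷ u ++ E ∷ v))) ≤ sumWords (suc (m + suc n)) g
  sumWords-E∷-E∷ m n g = begin
      sumWords m (λ u → sumWords n (λ v → g (E ∷ u ++ E ∷ v)))
    ≤⟨ sumWords-mono m (λ u _ → sumWords-E∷-≤ n (λ w → g (E ∷ u ++ w))) ⟩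
      sumWords m (λ u → sumWords (suc n) (λ w → g (E ∷ u ++ w)))
    ≡⟨ sumWords-++ m (suc n) (g ∘ (E ∷_)) ⟨
      sumWords (m + suc n) (g ∘ (E ∷_))
    ≤⟨ sumWords-E∷-≤ (m + suc n) g ⟩
      sumWords (suc (m + suc n)) g
    ∎
    where open ≤-Reasoning

  term≤sumWords : ∀ w (f : Word → ℕ) → f w ≤ sumWords (length w) f
  term≤sumWords []      f = ≤-refl
  term≤sumWords (E ∷ w) f = ≤-trans (term≤sumWords w (f ∘ (E ∷_))) (sumWords-E∷-≤ (length w) f)
  term≤sumWords (N ∷ w) f = ≤-trans (term≤sumWords w (f ∘ (N ∷_)))
    (≤-trans (m≤n+m _ (sumWords (length w) (f ∘ (E ∷_)))) (m≤m+n _ _))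
  term≤sumWords (S ∷ w) f = ≤-trans (term≤sumWords w (f ∘ (S ∷_))) (m≤n+m _ _)

  mirrorStep : Step → Step
  mirrorStep E = E
  mirrorStep N = S
  mirrorStep S = N

  mirror : Word → Word
  mirror = map mirrorStep

  sumWords-mirror : ∀ n (f : Word → ℕ) → sumWords n (f ∘ mirror) ≡ sumWords n f
  sumWords-mirror zero    f = refl
  sumWords-mirror (suc n) f
    rewrite sumWords-mirror n (f ∘ (E ∷_)) | sumWords-mirror n (f ∘ (S ∷_)) | sumWords-mirror n (f ∘ (N ∷_)) =
    swapLast (sumWords n (f ∘ (E ∷_))) (sumWords n (f ∘ (S ∷_))) (sumWords n (f ∘ (N ∷_)))
    where
    swapLast : ∀ a b c → a + b + c ≡ a + c + b
    swapLast = solve-∀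

  length-filter≡sum : ∀ {P : Word → Set} (P? : Decidable P) ws →
    length (filter P? ws) ≡ sum (map (𝟙 ∘ does ∘ P?) ws)
  length-filter≡sum P? []       = refl
  length-filter≡sum P? (w ∷ ws) with does (P? w)
  ... | true  = cong suc (length-filter≡sum P? ws)
  ... | false = length-filter≡sum P? ws

  sum-allSteps : ∀ n (f : Word → ℕ) → sum (map f (allSteps n)) ≡ sumWords n f
  sum-allSteps zero    f = +-identityʳ (f [])
  sum-allSteps (suc n) f = begin
      sum (map f (concatMap extend (allSteps n)))
    ≡⟨ sum-concatMap-extend (allSteps n) ⟩
      sum (map (λ w → f (E ∷ w) + f (N ∷ w) + f (S ∷ w)) (allSteps n))
    ≡⟨ sum-allSteps n _ ⟩
      sumWords n (λ w → f (E ∷ w) + f (N ∷ w) + f (S ∷ w))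
    ≡⟨ sumWords-+ n _ (f ∘ (S ∷_)) ⟩
      sumWords n (λ w → f (E ∷ w) + f (N ∷ w)) + sumWords n (f ∘ (S ∷_))
    ≡⟨ cong (_+ sumWords n (f ∘ (S ∷_))) (sumWords-+ n (f ∘ (E ∷_)) (f ∘ (N ∷_))) ⟩
      sumWords (suc n) f
    ∎
    where
    open ≡-Reasoning
    extend : Word → List Word
    extend w = (E ∷ w) ∷ (N ∷ w) ∷ (S ∷ w) ∷ []
    reassoc : ∀ a b c d → a + (b + (c + d)) ≡ a + b + c + d
    reassoc = solve-∀
    sum-concatMap-extend : ∀ ws →
      sum (map f (concatMap extend ws)) ≡ sum (map (λ w → f (E ∷ w) + f (N ∷ w) + f (S ∷ w)) ws)
    sum-concatMap-extend []       = refl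
    sum-concatMap-extend (w ∷ ws) = trans
      (cong (λ r → f (E ∷ w) + (f (N ∷ w) + (f (S ∷ w) + r))) (sum-concatMap-extend ws))
      (reassoc (f (E ∷ w)) (f (N ∷ w)) (f (S ∷ w)) _)

  b≡sumWords : ∀ n → b n ≡ sumWords n (𝟙 ∘ does ∘ counted?)
  b≡sumWords n = trans (length-filter≡sum counted? (allSteps n)) (sum-allSteps n _)

  compatible : Step → Step → Bool
  compatible N S = false
  compatible S N = false
  compatible _ _ = true

  -- reversalFree c w: the word c ∷ w has no reversal. An east step is compatible with every step, so
  -- reversalFree E w says that w itself has none.
  reversalFree : Step → Word → Bool
  reversalFree c []      = true
  reversalFree c (a ∷ w) = compatible c a ∧ reversalFree a w

  compatible-E : ∀ c → compatible c E ≡ true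
  compatible-E E = refl
  compatible-E N = refl
  compatible-E S = refl

  compatible-refl : ∀ a → compatible a a ≡ true
  compatible-refl E = refl
  compatible-refl N = refl
  compatible-refl S = refl

  compatible-mirror : ∀ a c → compatible (mirrorStep a) (mirrorStep c) ≡ compatible a c
  compatible-mirror E E = refl
  compatible-mirror E N = refl
  compatible-mirror E S = refl
  compatible-mirror N E = refl
  compatible-mirror N N = refl
  compatible-mirror N S = refl
  compatible-mirror S E = refl
  compatible-mirror S N = refl
  compatible-mirror S S = refl

  compatible⇒¬opposite : ∀ a c → compatible a c ≡ true → ¬ Opposite a c
  compatible⇒¬opposite N S () NS
  compatible⇒¬opposite S N () SN

  ¬opposite⇒compatible : ∀ a c → ¬ Opposite a c → compatible a c ≡ true
  ¬opposite⇒compatible E c _   = refl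
  ¬opposite⇒compatible N E _   = refl
  ¬opposite⇒compatible N N _   = refl
  ¬opposite⇒compatible N S ¬NS = ⊥-elim (¬NS NS)
  ¬opposite⇒compatible S E _   = refl
  ¬opposite⇒compatible S N ¬SN = ⊥-elim (¬SN SN)
  ¬opposite⇒compatible S S _   = refl

  reversalFree-++-E∷ : ∀ c u w → reversalFree c u ≡ true → reversalFree E w ≡ true →
    reversalFree c (u ++ E ∷ w) ≡ true
  reversalFree-++-E∷ c []      w _   rw rewrite compatible-E c = rw
  reversalFree-++-E∷ c (a ∷ u) w rcu rw rewrite ∧-conicalˡ (compatible c a) _ rcu =
    reversalFree-++-E∷ a u w (∧-conicalʳ (compatible c a) _ rcu) rw

  reversalFree-replicate : ∀ a k → reversalFree a (replicate k a) ≡ true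
  reversalFree-replicate a zero = refl
  reversalFree-replicate a (suc k) rewrite compatible-refl a = reversalFree-replicate a k

  reversalFree-E-replicate : ∀ a k → reversalFree E (replicate k a) ≡ true
  reversalFree-E-replicate a zero    = refl
  reversalFree-E-replicate a (suc k) = reversalFree-replicate a k

  reversalFree-mirror : ∀ c w → reversalFree (mirrorStep c) (mirror w) ≡ reversalFree c w
  reversalFree-mirror c []      = refl
  reversalFree-mirror c (a ∷ w) rewrite compatible-mirror c a | reversalFree-mirror a w = refl

  reversalFree⇒noReversal : ∀ c w → reversalFree c w ≡ true → NoReversal (c ∷ w)
  reversalFree⇒noReversal c []      _  = [-]
  reversalFree⇒noReversal c (a ∷ w) rf =
    compatible⇒¬opposite c a (∧-conicalˡ (compatible c a) _ rf)
    ∷ reversalFree⇒noReversal a w (∧-conicalʳ (compatible c a) _ rf)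

  noReversal⇒reversalFree : ∀ c w → NoReversal (c ∷ w) → reversalFree c w ≡ true
  noReversal⇒reversalFree c []      _          = refl
  noReversal⇒reversalFree c (a ∷ w) (¬o ∷ nr)
    rewrite ¬opposite⇒compatible c a ¬o = noReversal⇒reversalFree a w nr

  reversalFree-E⇒noReversal : ∀ w → reversalFree E w ≡ true → NoReversal w
  reversalFree-E⇒noReversal []      _  = []
  reversalFree-E⇒noReversal (a ∷ w) rf = reversalFree⇒noReversal a w rf

  noReversal⇒reversalFree-E : ∀ w → NoReversal w → reversalFree E w ≡ true
  noReversal⇒reversalFree-E []      _  = refl
  noReversal⇒reversalFree-E (a ∷ w) nr = noReversal⇒reversalFree a w nr

  -- Heights are natural numbers and a south step from height 0 stays at 0, so height h w is the true
  -- final height of w started at height h only when AboveAxis h w.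
  height : ℕ → Word → ℕ
  height h []      = h
  height h (E ∷ w) = height h w
  height h (N ∷ w) = height (suc h) w
  height h (S ∷ w) = height (pred h) w

  AboveAxis : ℕ → Word → Set
  AboveAxis h []      = ⊤
  AboveAxis h (E ∷ w) = AboveAxis h w
  AboveAxis h (N ∷ w) = AboveAxis (suc h) w
  AboveAxis h (S ∷ w) = 1 ≤ h × AboveAxis (pred h) w

  height-++ : ∀ h u w → height h (u ++ w) ≡ height (height h u) w
  height-++ h []      w = refl
  height-++ h (E ∷ u) w = height-++ h u w
  height-++ h (N ∷ u) w = height-++ (suc h) u w
  height-++ h (S ∷ u) w = height-++ (pred h) u w

  AboveAxis-++ : ∀ h u w → AboveAxis h u → AboveAxis (height h u) w → AboveAxis h (u ++ w)
  AboveAxis-++ h []      w _          aw = aw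
  AboveAxis-++ h (E ∷ u) w au         aw = AboveAxis-++ h u w au aw
  AboveAxis-++ h (N ∷ u) w au         aw = AboveAxis-++ (suc h) u w au aw
  AboveAxis-++ h (S ∷ u) w (1≤h , au) aw = 1≤h , AboveAxis-++ (pred h) u w au aw

  AboveAxis-short : ∀ h w → length w ≤ h → AboveAxis h w
  AboveAxis-short h       []      _         = tt
  AboveAxis-short h       (E ∷ w) w<h       = AboveAxis-short h w (<⇒≤ w<h)
  AboveAxis-short h       (N ∷ w) w<h       = AboveAxis-short (suc h) w (m<n⇒m≤1+n w<h)
  AboveAxis-short (suc h) (S ∷ w) (s≤s w≤h) = s≤s z≤n , AboveAxis-short h w w≤h

  height≤ : ∀ h w → height h w ≤ h + length w
  height≤ h []      = ≤-reflexive (sym (+-identityʳ h))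
  height≤ h (E ∷ w) = ≤-trans (height≤ h w) (+-monoʳ-≤ h (n≤1+n _))
  height≤ h (N ∷ w) = ≤-trans (height≤ (suc h) w) (≤-reflexive (sym (+-suc h _)))
  height≤ h (S ∷ w) = ≤-trans (height≤ (pred h) w)
    (≤-trans (+-monoˡ-≤ (length w) (pred[n]≤n {h})) (≤-trans (n≤1+n _) (≤-reflexive (sym (+-suc h _)))))

  ≤height : ∀ h w → h ≤ height h w + length w
  ≤height h       []      = ≤-reflexive (sym (+-identityʳ h))
  ≤height h       (E ∷ w) = ≤-trans (≤height h w) (≤-trans (n≤1+n _) (≤-reflexive (sym (+-suc _ _))))
  ≤height h       (N ∷ w) =
    ≤-trans (n≤1+n h) (≤-trans (≤height (suc h) w) (≤-trans (n≤1+n _) (≤-reflexive (sym (+-suc _ _)))))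
  ≤height zero    (S ∷ w) = z≤n
  ≤height (suc h) (S ∷ w) = ≤-trans (s≤s (≤height h w)) (≤-reflexive (sym (+-suc _ _)))

  height-mirror : ∀ w h h′ → length w ≤ h → length w ≤ h′ → height h w + height h′ (mirror w) ≡ h + h′
  height-mirror []      h       h′       _         _          = refl
  height-mirror (E ∷ w) h       h′       w<h       w<h′       = height-mirror w h h′ (<⇒≤ w<h) (<⇒≤ w<h′)
  height-mirror (N ∷ w) h       (suc h′) w<h       (s≤s w≤h′) =
    trans (height-mirror w (suc h) h′ (m<n⇒m≤1+n w<h) w≤h′) (sym (+-suc h h′))
  height-mirror (S ∷ w) (suc h) h′       (s≤s w≤h) w<h′       =
    trans (height-mirror w h (suc h′) w≤h (m<n⇒m≤1+n w<h′)) (+-suc h h′)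

  walk-in-quadrant : ∀ x y w → 0ℤ ℤ.≤ x → AboveAxis y w →
    All InQuadrant (vertices (x , ℤ.+ y) w) × proj₂ (endpoint (x , ℤ.+ y) w) ≡ ℤ.+ height y w
  walk-in-quadrant x y       []      0≤x _        = (0≤x , ℤ.+≤+ z≤n) ∷ [] , refl
  walk-in-quadrant x y       (E ∷ w) 0≤x aw       = map₁ ((0≤x , ℤ.+≤+ z≤n) ∷_)
    (walk-in-quadrant (x ℤ.+ ℤ.1ℤ) y w (ℤ.≤-trans 0≤x (ℤ.i≤i+j x ℤ.1ℤ)) aw)
  walk-in-quadrant x y       (N ∷ w) 0≤x aw rewrite +-comm y 1 =
    map₁ ((0≤x , ℤ.+≤+ z≤n) ∷_) (walk-in-quadrant x (suc y) w 0≤x aw)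
  walk-in-quadrant x (suc y) (S ∷ w) 0≤x (_ , aw) = map₁ ((0≤x , ℤ.+≤+ z≤n) ∷_) (walk-in-quadrant x y w 0≤x aw)

  counted⇒reversalFree : ∀ w → Counted w → reversalFree E w ≡ true
  counted⇒reversalFree w (nr , _ , _) = noReversal⇒reversalFree-E w nr

  -- pdw E n is the number of partially directed walks of length n, pdw N n the number of those that
  -- may follow a north step.
  pdw : Step → ℕ → ℕ
  pdw c n = sumWords n (𝟙 ∘ reversalFree c)

  pdw-S≡pdw-N : ∀ n → pdw S n ≡ pdw N n
  pdw-S≡pdw-N n = begin
      pdw S n
    ≡⟨ sumWords-mirror n (𝟙 ∘ reversalFree S) ⟨
      sumWords n (λ w → 𝟙 (reversalFree S (mirror w)))
    ≡⟨ sumWords-cong n (λ w → cong 𝟙 (reversalFree-mirror N w)) ⟩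
      pdw N n
    ∎
    where open ≡-Reasoning

  pdw-E-suc : ∀ n → pdw E (suc n) ≡ pdw E n + 2 * pdw N n
  pdw-E-suc n = begin
      pdw E n + pdw N n + pdw S n
    ≡⟨ cong (pdw E n + pdw N n +_) (pdw-S≡pdw-N n) ⟩
      pdw E n + pdw N n + pdw N n
    ≡⟨ twice (pdw E n) (pdw N n) ⟩
      pdw E n + 2 * pdw N n
    ∎
    where
    open ≡-Reasoning
    twice : ∀ x y → x + y + y ≡ x + 2 * y
    twice = solve-∀

  pdw-N-suc : ∀ n → pdw N (suc n) ≡ pdw E n + pdw N n
  pdw-N-suc n = trans (cong (pdw E n + pdw N n +_) (sumWords-zero n)) (+-identityʳ _)

  b≤pdw : ∀ n → b n ≤ pdw E n
  b≤pdw n = subst (_≤ pdw E n) (sym (b≡sumWords n))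
    (sumWords-mono n (λ w _ → 𝟙-does-≤ (counted? w) (counted⇒reversalFree w)))

  -- With s = g / h ≥ √2, the vector (s , 1) is a super-solution of the recurrence of (pdw E , pdw N),
  -- growing by the factor 1 + s.
  pdw-upper : ∀ g h → 2 * h * h ≤ g * g → ∀ n →
    pdw E n * h ^ suc n ≤ g * (g + h) ^ n × pdw N n * h ^ suc n ≤ h * (g + h) ^ n
  pdw-upper g h 2h²≤g² zero =
    ≤-trans (≤-reflexive (e h)) (≤-trans h≤g (≤-reflexive (sym (*-identityʳ g)))) ,
    ≤-reflexive (trans (e h) (sym (*-identityʳ h)))
    where
    e : ∀ h → 1 * (h * 1) ≡ h
    e = solve-∀
    h≤g : h ≤ g
    h≤g = *-self-cancel-≤ (≤-trans (*-monoˡ-≤ h (m≤n*m h 2)) 2h²≤g²)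
  pdw-upper g h 2h²≤g² (suc n) = E-bound , N-bound
    where
    x = pdw E n
    y = pdw N n
    R = (g + h) ^ n
    W = h ^ suc n
    IH = pdw-upper g h 2h²≤g² n
    E-bound : pdw E (suc n) * (h * W) ≤ g * ((g + h) * R)
    E-bound = begin
        pdw E (suc n) * (h * W)
      ≡⟨ cong (_* (h * W)) (pdw-E-suc n) ⟩
        (x + 2 * y) * (h * W)
      ≡⟨ e₁ x y h W ⟩
        h * (x * W) + 2 * h * (y * W)
      ≤⟨ +-mono-≤ (*-monoʳ-≤ h (proj₁ IH)) (*-monoʳ-≤ (2 * h) (proj₂ IH)) ⟩
        h * (g * R) + 2 * h * (h * R)
      ≡⟨ e₂ g h R ⟩
        (2 * h * h + g * h) * R
      ≤⟨ *-monoˡ-≤ R (+-monoˡ-≤ (g * h) 2h²≤g²) ⟩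
        (g * g + g * h) * R
      ≡⟨ e₃ g h R ⟩
        g * ((g + h) * R)
      ∎
      where
      open ≤-Reasoning
      e₁ : ∀ x y h W → (x + 2 * y) * (h * W) ≡ h * (x * W) + 2 * h * (y * W)
      e₁ = solve-∀
      e₂ : ∀ g h R → h * (g * R) + 2 * h * (h * R) ≡ (2 * h * h + g * h) * R
      e₂ = solve-∀
      e₃ : ∀ g h R → (g * g + g * h) * R ≡ g * ((g + h) * R)
      e₃ = solve-∀
    N-bound : pdw N (suc n) * (h * W) ≤ h * ((g + h) * R)
    N-bound = begin
        pdw N (suc n) * (h * W)
      ≡⟨ cong (_* (h * W)) (pdw-N-suc n) ⟩
        (x + y) * (h * W)
      ≡⟨ e₁ x y h W ⟩
        h * (x * W) + h * (y * W)
      ≤⟨ +-mono-≤ (*-monoʳ-≤ h (proj₁ IH)) (*-monoʳ-≤ h (proj₂ IH)) ⟩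
        h * (g * R) + h * (h * R)
      ≡⟨ e₂ g h R ⟩
        h * ((g + h) * R)
      ∎
      where
      open ≤-Reasoning
      e₁ : ∀ x y h W → (x + y) * (h * W) ≡ h * (x * W) + h * (y * W)
      e₁ = solve-∀
      e₂ : ∀ g h R → h * (g * R) + h * (h * R) ≡ h * ((g + h) * R)
      e₂ = solve-∀

  -- Dually, for s = g / h ≤ √2 the vector (s , 1) is a sub-solution.
  pdw-lower : ∀ g h → g * g ≤ 2 * h * h → ∀ n →
    g * (g + h) ^ n ≤ pdw E n * (g + h) * h ^ n × h * (g + h) ^ n ≤ pdw N n * (g + h) * h ^ n
  pdw-lower g h g²≤2h² zero = subst₂ _≤_ (sym (*-identityʳ g)) (sym (e g h)) (m≤m+n g h) ,
                               subst₂ _≤_ (sym (*-identityʳ h)) (sym (e g h)) (m≤n+m h g)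
    where
    e : ∀ g h → 1 * (g + h) * 1 ≡ g + h
    e = solve-∀
  pdw-lower g h g²≤2h² (suc n) = E-bound , N-bound
    where
    x = pdw E n
    y = pdw N n
    a = g + h
    P = a ^ n
    Q = h ^ n
    IH = pdw-lower g h g²≤2h² n
    E-bound : g * (a * P) ≤ pdw E (suc n) * a * (h * Q)
    E-bound = begin
        g * (a * P)
      ≡⟨ e₁ g h P ⟩
        (g * g + g * h) * P
      ≤⟨ *-monoˡ-≤ P (+-monoˡ-≤ (g * h) g²≤2h²) ⟩
        (2 * h * h + g * h) * P
      ≡⟨ e₂ g h P ⟩
        h * (g * P) + 2 * h * (h * P)
      ≤⟨ +-mono-≤ (*-monoʳ-≤ h (proj₁ IH)) (*-monoʳ-≤ (2 * h) (proj₂ IH)) ⟩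
        h * (x * a * Q) + 2 * h * (y * a * Q)
      ≡⟨ e₃ h x y a Q ⟩
        (x + 2 * y) * a * (h * Q)
      ≡⟨ cong (λ z → z * a * (h * Q)) (pdw-E-suc n) ⟨
        pdw E (suc n) * a * (h * Q)
      ∎
      where
      open ≤-Reasoning
      e₁ : ∀ g h P → g * ((g + h) * P) ≡ (g * g + g * h) * P
      e₁ = solve-∀
      e₂ : ∀ g h P → (2 * h * h + g * h) * P ≡ h * (g * P) + 2 * h * (h * P)
      e₂ = solve-∀
      e₃ : ∀ h x y a Q → h * (x * a * Q) + 2 * h * (y * a * Q) ≡ (x + 2 * y) * a * (h * Q)
      e₃ = solve-∀
    N-bound : h * (a * P) ≤ pdw N (suc n) * a * (h * Q)
    N-bound = begin
        h * (a * P)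
      ≡⟨ e₁ g h P ⟩
        h * (g * P) + h * (h * P)
      ≤⟨ +-mono-≤ (*-monoʳ-≤ h (proj₁ IH)) (*-monoʳ-≤ h (proj₂ IH)) ⟩
        h * (x * a * Q) + h * (y * a * Q)
      ≡⟨ e₂ h x y a Q ⟩
        (x + y) * a * (h * Q)
      ≡⟨ cong (λ z → z * a * (h * Q)) (pdw-N-suc n) ⟨
        pdw N (suc n) * a * (h * Q)
      ∎
      where
      open ≤-Reasoning
      e₁ : ∀ g h P → h * ((g + h) * P) ≡ h * (g * P) + h * (h * P)
      e₁ = solve-∀
      e₂ : ∀ h x y a Q → h * (x * a * Q) + h * (y * a * Q) ≡ (x + y) * a * (h * Q)
      e₂ = solve-∀

  WalkTo : ℕ → Word → Set
  WalkTo h ρ = reversalFree E ρ ≡ true × AboveAxis 0 ρ × height 0 ρ ≡ h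

  WalkTo-extend : ∀ {h h′} ρ w → WalkTo h ρ → reversalFree E w ≡ true → AboveAxis h w → height h w ≡ h′ →
    WalkTo h′ (ρ ++ E ∷ w)
  WalkTo-extend {h} ρ w (rfρ , aρ , hρ) rfw aw hw =
    reversalFree-++-E∷ E ρ w rfρ rfw ,
    AboveAxis-++ 0 ρ (E ∷ w) aρ (subst (λ z → AboveAxis z w) (sym hρ) aw) ,
    trans (height-++ 0 ρ (E ∷ w)) (trans (cong (λ z → height z w) hρ) hw)

  WalkTo-E^ : ∀ {h} k w → WalkTo h w → WalkTo h (replicate k E ++ w)
  WalkTo-E^ zero    w walk = walk
  WalkTo-E^ (suc k) w walk = WalkTo-E^ k w walk

  WalkTo-N^ : ∀ k → WalkTo k (replicate k N)
  WalkTo-N^ k = reversalFree-E-replicate N k , above k 0 , trans (climb k 0) (+-identityʳ k)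
    where
    above : ∀ k y → AboveAxis y (replicate k N)
    above zero    y = tt
    above (suc k) y = above k (suc y)
    climb : ∀ k y → height y (replicate k N) ≡ k + y
    climb zero    y = refl
    climb (suc k) y = trans (climb k (suc y)) (+-suc k y)

  WalkTo-0⇒counted : ∀ w → WalkTo 0 w → Counted w
  WalkTo-0⇒counted w (rf , aw , h≡0) =
    let inQ , end = walk-in-quadrant 0ℤ 0 w (ℤ.+≤+ z≤n) aw
    in reversalFree-E⇒noReversal w rf , inQ , trans end (cong ℤ.+_ h≡0)

  WalkTo-close : ∀ {h} ρ → WalkTo h ρ → Counted (ρ ++ E ∷ replicate h S)
  WalkTo-close {h} ρ walk = WalkTo-0⇒counted _
    (WalkTo-extend ρ (replicate h S) walk (reversalFree-E-replicate S h)
      (AboveAxis-short h (replicate h S) (≤-reflexive (length-replicate h))) (descend h))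
    where
    descend : ∀ k → height k (replicate k S) ≡ 0
    descend zero    = refl
    descend (suc k) = descend k

  completions : Word → ℕ → ℕ
  completions ρ n = sumWords n (λ t → 𝟙 (does (counted? (ρ ++ t))))

  -- Walks are assembled from an initial climb to height 2L, blocks E u E v of length 2L + 2, and a
  -- final descent; u is a leg (it stays within L of 2L, so never leaves the quadrant), v the mirror
  -- image of a leg, so each block returns to height 2L.
  module Blocks (L e : ℕ) where

    H : ℕ
    H = L + L

    Leg : Word → Bool
    Leg u = reversalFree E u ∧ (height H u ≡ᵇ e)

    legs : ℕ
    legs = sumWords L (𝟙 ∘ Leg)

    blockLength : ℕ
    blockLength = suc (L + suc L)

    leg-down : ∀ u → length u ≡ L → Leg u ≡ true →
      reversalFree E u ≡ true × AboveAxis H u × height H u ≡ e × L ≤ e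
    leg-down u |u|≡L leg = rf , AboveAxis-short H u (subst (_≤ H) (sym |u|≡L) (m≤m+n L L)) , hu , L≤e
      where
      rf = ∧-conicalˡ (reversalFree E u) _ leg
      hu = ≡ᵇ-true⇒≡ (height H u) e (∧-conicalʳ (reversalFree E u) _ leg)
      L≤e : L ≤ e
      L≤e = +-cancelʳ-≤ L L e (subst (H ≤_) (cong₂ _+_ hu |u|≡L) (≤height H u))

    leg-up : ∀ v → length v ≡ L → Leg (mirror v) ≡ true →
      reversalFree E v ≡ true × AboveAxis e v × height e v ≡ H
    leg-up v |v|≡L leg with leg-down (mirror v) (trans (length-map mirrorStep v) |v|≡L) leg
    ... | rf , _ , hv , L≤e =
      trans (sym (reversalFree-mirror E v)) rf ,
      AboveAxis-short e v (subst (_≤ e) (sym |v|≡L) L≤e) ,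
      +-cancelʳ-≡ e (height e v) H (begin
          height e v + e
        ≡⟨ cong (height e v +_) hv ⟨
          height e v + height H (mirror v)
        ≡⟨ height-mirror v e H (subst (_≤ e) (sym |v|≡L) L≤e) (subst (_≤ H) (sym |v|≡L) (m≤m+n L L)) ⟩
          e + H
        ≡⟨ +-comm e H ⟩
          H + e
        ∎)
      where open ≡-Reasoning

    WalkTo-block : ∀ ρ u v → WalkTo H ρ → length u ≡ L → length v ≡ L →
      Leg u ≡ true → Leg (mirror v) ≡ true → WalkTo H (ρ ++ E ∷ u ++ E ∷ v)
    WalkTo-block ρ u v walk |u|≡L |v|≡L legu legv with leg-down u |u|≡L legu | leg-up v |v|≡L legv
    ... | rfu , au , hu , _ | rfv , av , hv =
      subst (WalkTo H) (++-assoc ρ (E ∷ u) (E ∷ v))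
        (WalkTo-extend (ρ ++ E ∷ u) v (WalkTo-extend ρ u walk rfu au hu) rfv av hv)

    completions-lower : ∀ q ρ → WalkTo H ρ → (legs * legs) ^ q ≤ completions ρ (blockLength * q + suc H)
    completions-lower zero ρ walk rewrite *-zeroʳ blockLength = begin
        1
      ≡⟨ cong 𝟙 (dec-true (counted? (ρ ++ closing)) (WalkTo-close ρ walk)) ⟨
        𝟙 (does (counted? (ρ ++ closing)))
      ≤⟨ term≤sumWords closing (λ t → 𝟙 (does (counted? (ρ ++ t)))) ⟩
        completions ρ (length closing)
      ≡⟨ cong (λ n → completions ρ (suc n)) (length-replicate H) ⟩
        completions ρ (suc H)
      ∎
      where
      open ≤-Reasoning
      closing = E ∷ replicate H S
    completions-lower (suc q) ρ walk = begin
        (legs * legs) ^ suc q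
      ≡⟨ regroup legs P ⟩
        legs * (P * legs)
      ≡⟨ cong (λ z → legs * (P * z)) (sumWords-mirror L (𝟙 ∘ Leg)) ⟨
        legs * (P * sumWords L (𝟙 ∘ Leg ∘ mirror))
      ≡⟨ cong (legs *_) (sumWords-*ˡ L P (𝟙 ∘ Leg ∘ mirror)) ⟨
        legs * sumWords L (λ v → P * 𝟙 (Leg (mirror v)))
      ≡⟨ sumWords-product L L (𝟙 ∘ Leg) (λ v → P * 𝟙 (Leg (mirror v))) ⟨
        sumWords L (λ u → sumWords L (λ v → 𝟙 (Leg u) * (P * 𝟙 (Leg (mirror v)))))
      ≤⟨ sumWords-mono L (λ u |u|≡L → sumWords-mono L (λ v |v|≡L →
           𝟙*[p*𝟙]≤ (Leg u) (Leg (mirror v)) (λ legu legv →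
             completions-lower q (ρ ++ E ∷ u ++ E ∷ v) (WalkTo-block ρ u v walk |u|≡L |v|≡L legu legv)))) ⟩
        sumWords L (λ u → sumWords L (λ v → completions (ρ ++ E ∷ u ++ E ∷ v) R))
      ≤⟨ sumWords-E∷-E∷ L L (λ β → completions (ρ ++ β) R) ⟩
        sumWords blockLength (λ β → completions (ρ ++ β) R)
      ≡⟨ sumWords-cong blockLength (λ β →
           sumWords-cong R (λ t → cong (𝟙 ∘ does ∘ counted?) (++-assoc ρ β t))) ⟩
        sumWords blockLength (λ β → sumWords R (λ t → 𝟙 (does (counted? (ρ ++ β ++ t)))))
      ≡⟨ sumWords-++ blockLength R (λ w → 𝟙 (does (counted? (ρ ++ w)))) ⟨
        completions ρ (blockLength + R)
      ≡⟨ cong (completions ρ) (length-split blockLength q (suc H)) ⟨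
        completions ρ (blockLength * suc q + suc H)
      ∎
      where
      open ≤-Reasoning
      R = blockLength * q + suc H
      P = (legs * legs) ^ q
      regroup : ∀ x p → x * x * p ≡ x * (p * x)
      regroup = solve-∀
      length-split : ∀ k q m → k * suc q + m ≡ k + (k * q + m)
      length-split = solve-∀

    b-lower : ∀ pad q → (legs * legs) ^ q ≤ b (pad + H + (blockLength * q + suc H))
    b-lower pad q = begin
        (legs * legs) ^ q
      ≤⟨ completions-lower q ρ₀ (WalkTo-E^ pad (replicate H N) (WalkTo-N^ H)) ⟩
        completions ρ₀ R
      ≤⟨ term≤sumWords ρ₀ (λ ρ → completions ρ R) ⟩
        sumWords (length ρ₀) (λ ρ → completions ρ R)
      ≡⟨ cong (λ n → sumWords n (λ ρ → completions ρ R)) |ρ₀| ⟩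
        sumWords (pad + H) (λ ρ → completions ρ R)
      ≡⟨ sumWords-++ (pad + H) R (𝟙 ∘ does ∘ counted?) ⟨
        sumWords (pad + H + R) (𝟙 ∘ does ∘ counted?)
      ≡⟨ b≡sumWords (pad + H + R) ⟨
        b (pad + H + R)
      ∎
      where
      open ≤-Reasoning
      R = blockLength * q + suc H
      ρ₀ = replicate pad E ++ replicate H N
      |ρ₀| : length ρ₀ ≡ pad + H
      |ρ₀| = trans (length-++ (replicate pad E)) (cong₂ _+_ (length-replicate pad) (length-replicate H))

  -- Every partially directed walk of length L is a leg for e = its final height from 2L, which lies in
  -- [L, 3L]; so some e carries at least a 1/(3L+1) share of them.
  pdw≤legs : ∀ L → ∃ λ e → pdw E L ≤ suc (L + L + L) * Blocks.legs L e
  pdw≤legs L with pigeonhole (suc (L + L + L)) (Blocks.legs L)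
  ... | e , Σ≤ = e , (begin
      pdw E L
    ≤⟨ sumWords-mono L (λ u |u|≡L → ≤-trans (≤-reflexive (cong 𝟙 (is-leg u)))
         (term≤sumBelow K (λ e → 𝟙 (Blocks.Leg L e u))
           (s≤s (subst (λ l → height (L + L) u ≤ L + L + l) |u|≡L (height≤ (L + L) u))))) ⟩
      sumWords L (λ u → sumBelow K (λ e → 𝟙 (Blocks.Leg L e u)))
    ≡⟨ sumWords-sumBelow L K (λ e u → 𝟙 (Blocks.Leg L e u)) ⟩
      sumBelow K (Blocks.legs L)
    ≤⟨ Σ≤ ⟩
      K * Blocks.legs L e
    ∎)
    where
    open ≤-Reasoning
    K = suc (L + L + L)
    is-leg : ∀ u → reversalFree E u ≡ Blocks.Leg L (height (L + L) u) u
    is-leg u = sym (trans (cong (reversalFree E u ∧_) (≡ᵇ-refl (height (L + L) u))) (∧-identityʳ _))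

  legs-lower-bound : ∀ g h {L} e → g * g ≤ 2 * h * h → pdw E L ≤ suc (L + L + L) * Blocks.legs L e →
    g * (g + h) ^ L ≤ suc (L + L + L) * (g + h) * h ^ L * Blocks.legs L e
  legs-lower-bound g h {L} e g²≤2h² pdw≤ = begin
      g * (g + h) ^ L
    ≤⟨ proj₁ (pdw-lower g h g²≤2h² L) ⟩
      pdw E L * (g + h) * h ^ L
    ≤⟨ *-monoˡ-≤ (h ^ L) (*-monoˡ-≤ (g + h) pdw≤) ⟩
      K * A * (g + h) * h ^ L
    ≡⟨ move-A K A (g + h) (h ^ L) ⟩
      K * (g + h) * h ^ L * A
    ∎
    where
    open ≤-Reasoning
    K = suc (L + L + L)
    A = Blocks.legs L e
    move-A : ∀ K A s p → K * A * s * p ≡ K * s * p * A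
    move-A = solve-∀

  -- With g / h ∈ (t / d, √2], the polynomial loss 3L + 1 in legs-lower-bound is beaten by the
  -- exponential gap between 1 + g / h and 1 + t / d.
  legs-exceed-power : ∀ {d t g h L} e → 1 ≤ d → 1 ≤ g → 1 ≤ L → g * g ≤ 2 * h * h →
    4 * (d + t) * (g + h) * L * ((d + t) * h) ^ L < ((g + h) * d) ^ L →
    pdw E L ≤ suc (L + L + L) * Blocks.legs L e →
    (d + t) ^ suc L < Blocks.legs L e * d ^ suc L
  legs-exceed-power {d} {t} {g} {h} {L} e 1≤d 1≤g 1≤L g²≤2h² gap pdw≤ = *-cancelˡ-< Z _ _ (begin-strict
      Z * a ^ suc L
    ≡⟨ e₁ K (g + h) (h ^ L) a (a ^ L) ⟩
      K * (g + h) * a * (a ^ L * h ^ L)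
    ≡⟨ cong (K * (g + h) * a *_) (^-distribʳ-* a h L) ⟨
      K * (g + h) * a * (a * h) ^ L
    ≤⟨ *-monoˡ-≤ ((a * h) ^ L) (*-monoˡ-≤ a (*-monoˡ-≤ (g + h) K≤4L)) ⟩
      4 * L * (g + h) * a * (a * h) ^ L
    ≡⟨ cong (_* (a * h) ^ L) (e₂ L (g + h) a) ⟩
      4 * a * (g + h) * L * (a * h) ^ L
    <⟨ gap ⟩
      ((g + h) * d) ^ L
    ≡⟨ ^-distribʳ-* (g + h) d L ⟩
      (g + h) ^ L * d ^ L
    ≤⟨ m≤n*m _ (g * d) {{>-nonZero (*-mono-≤ 1≤g 1≤d)}} ⟩
      g * d * ((g + h) ^ L * d ^ L)
    ≡⟨ e₃ g d ((g + h) ^ L) (d ^ L) ⟩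
      g * (g + h) ^ L * d ^ suc L
    ≤⟨ *-monoˡ-≤ (d ^ suc L) (legs-lower-bound g h {L} e g²≤2h² pdw≤) ⟩
      Z * A * d ^ suc L
    ≡⟨ *-assoc Z A (d ^ suc L) ⟩
      Z * (A * d ^ suc L)
    ∎)
    where
    open ≤-Reasoning
    a = d + t
    A = Blocks.legs L e
    K = suc (L + L + L)
    Z = K * (g + h) * h ^ L
    K≤4L : K ≤ 4 * L
    K≤4L = ≤-trans (+-monoˡ-≤ (L + L + L) 1≤L) (≤-reflexive (four L))
      where
      four : ∀ L → L + (L + L + L) ≡ 4 * L
      four = solve-∀
    e₁ : ∀ K s p a r → K * s * p * (a * r) ≡ K * s * a * (r * p)
    e₁ = solve-∀
    e₂ : ∀ L s a → 4 * L * s * a ≡ 4 * a * s * L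
    e₂ = solve-∀
    e₃ : ∀ g d p r → g * d * (p * r) ≡ g * p * (d * r)
    e₃ = solve-∀

  legs-growth : ∀ d t → 1 ≤ d → t * t < 2 * d * d →
    ∃ λ L → ∃ λ e → (d + t) ^ suc L < Blocks.legs L e * d ^ suc L
  legs-growth d t 1≤d t²<2d² =
    let g , h , 1≤g , g²≤2h² , Y<X = below-√2 d t 1≤d t²<2d²
        Q , beat = eventually-C*q*y^q<x^q (4 * (d + t) * (g + h)) Y<X
        e , pdw≤ = pdw≤legs (suc Q)
    in suc Q , e , legs-exceed-power e 1≤d 1≤g (s≤s z≤n) g²≤2h² (beat (suc Q) (n≤1+n Q)) pdw≤

  -- Prefixing pad < k east steps reaches every length, not only those of the form n₀ + k q.
  b-growth : ∀ L e a d → 1 ≤ a → 1 ≤ d → a ^ suc L < Blocks.legs L e * d ^ suc L →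
    ∃ λ n₀ → ∀ n → n₀ ≤ n → a ^ n < b n * d ^ n
  b-growth L e a d 1≤a 1≤d half =
    let Q , beat = eventually-C*y^q<x^q (a ^ (k + n₀)) block<
    in n₀ + k * Q , λ n n≥ →
       let pad , q , pad<k , Q≤q , n≡ = progression-cover k n₀ Q n n≥
       in subst (λ m → a ^ m < b m * d ^ m) (sym n≡) (along pad q pad<k (beat q Q≤q))
    where
    open Blocks L e
    open ≤-Reasoning
    k = blockLength
    n₀ = H + suc H
    instance
      a≢0 : NonZero a
      a≢0 = >-nonZero 1≤a
      d≢0 : NonZero d
      d≢0 = >-nonZero 1≤d
    block< : a ^ k < legs * legs * d ^ k
    block< = begin-strict
        a ^ (suc L + suc L)
      ≡⟨ ^-distribˡ-+-* a (suc L) (suc L) ⟩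
        a ^ suc L * a ^ suc L
      <⟨ *-mono-< half half ⟩
        legs * d ^ suc L * (legs * d ^ suc L)
      ≡⟨ interchange legs (d ^ suc L) ⟩
        legs * legs * (d ^ suc L * d ^ suc L)
      ≡⟨ cong (legs * legs *_) (^-distribˡ-+-* d (suc L) (suc L)) ⟨
        legs * legs * d ^ (suc L + suc L)
      ∎
      where
      interchange : ∀ x p → x * p * (x * p) ≡ x * x * (p * p)
      interchange = solve-∀
    along : ∀ pad q → pad < k → a ^ (k + n₀) * (a ^ k) ^ q < (legs * legs * d ^ k) ^ q →
      a ^ (pad + n₀ + k * q) < b (pad + n₀ + k * q) * d ^ (pad + n₀ + k * q)
    along pad q pad<k beat = begin-strict
        a ^ (pad + n₀ + k * q)
      ≡⟨ ^-distribˡ-+-* a (pad + n₀) (k * q) ⟩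
        a ^ (pad + n₀) * a ^ (k * q)
      ≡⟨ cong (a ^ (pad + n₀) *_) (^-*-assoc a k q) ⟨
        a ^ (pad + n₀) * (a ^ k) ^ q
      ≤⟨ *-monoˡ-≤ ((a ^ k) ^ q) (^-monoʳ-≤ a (+-monoˡ-≤ n₀ (<⇒≤ pad<k))) ⟩
        a ^ (k + n₀) * (a ^ k) ^ q
      <⟨ beat ⟩
        (legs * legs * d ^ k) ^ q
      ≡⟨ ^-distribʳ-* (legs * legs) (d ^ k) q ⟩
        (legs * legs) ^ q * (d ^ k) ^ q
      ≡⟨ cong ((legs * legs) ^ q *_) (^-*-assoc d k q) ⟩
        (legs * legs) ^ q * d ^ (k * q)
      ≤⟨ *-mono-≤ (subst (λ m → (legs * legs) ^ q ≤ b m) (sym (length≡ pad H q k)) (b-lower pad q))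
                  (^-monoʳ-≤ d (m≤n+m (k * q) (pad + n₀))) ⟩
        b (pad + n₀ + k * q) * d ^ (pad + n₀ + k * q)
      ∎
      where
      length≡ : ∀ pad H q k → pad + (H + suc H) + k * q ≡ pad + H + (k * q + suc H)
      length≡ = solve-∀

  b-lower-bound-1+t/d : ∀ d t → 1 ≤ d → t * t < 2 * d * d →
    ∃ λ n₀ → ∀ n → n₀ ≤ n → (d + t) ^ n < b n * d ^ n
  b-lower-bound-1+t/d d t 1≤d t²<2d² =
    let L , e , half = legs-growth d t 1≤d t²<2d²
    in b-growth L e (d + t) d (≤-trans 1≤d (m≤m+n d t)) 1≤d half

  b-lower-bound : ∀ a d → 1 ≤ d → a * a < 2 * a * d + d * d →
    ∃ λ n₀ → ∀ n → n₀ ≤ n → a ^ n < b n * d ^ n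
  b-lower-bound a d 1≤d a²< with a ≤? d
  ... | yes a≤d =
    let n₀ , bound = b-lower-bound-1+t/d d 0 1≤d (*-mono-≤ (*-mono-≤ (s≤s (z≤n {1})) 1≤d) 1≤d)
    in n₀ , λ n n₀≤n → ≤-<-trans (^-monoˡ-≤ n (≤-trans a≤d (m≤m+n d 0))) (bound n n₀≤n)
  ... | no a≰d = subst (λ a → ∃ λ n₀ → ∀ n → n₀ ≤ n → a ^ n < b n * d ^ n) d+t≡a
                   (b-lower-bound-1+t/d d t 1≤d t²<2d²)
    where
    t = a ∸ d
    d+t≡a : d + t ≡ a
    d+t≡a = m+[n∸m]≡n (<⇒≤ (≰⇒> a≰d))
    t²<2d² : t * t < 2 * d * d
    t²<2d² = +-cancelˡ-< (d * d + 2 * d * t) (t * t) (2 * d * d)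
      (subst₂ _<_ (e₁ d t) (e₂ d t) (subst (λ a → a * a < 2 * a * d + d * d) (sym d+t≡a) a²<))
      where
      e₁ : ∀ d t → (d + t) * (d + t) ≡ d * d + 2 * d * t + t * t
      e₁ = solve-∀
      e₂ : ∀ d t → 2 * (d + t) * d + d * d ≡ d * d + 2 * d * t + 2 * d * d
      e₂ = solve-∀

  b-upper-bound : ∀ e h₀ → 1 ≤ e → 2 * e * e < h₀ * h₀ →
    ∃ λ n₀ → ∀ n → n₀ ≤ n → b n * e ^ n < (e + h₀) ^ n
  b-upper-bound e h₀ 1≤e 2e²<h₀² =
    let g , h , 1≤h , 2h²≤g² , Y<X = above-√2 e h₀ 1≤e 2e²<h₀²
        n₀ , beat = eventually-C*y^q<x^q g Y<X
    in n₀ , λ n n₀≤n → *-cancelʳ-< (h ^ suc n) _ _ (begin-strict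
        b n * e ^ n * h ^ suc n
      ≡⟨ swap (b n) (e ^ n) (h ^ suc n) ⟩
        b n * h ^ suc n * e ^ n
      ≤⟨ *-monoˡ-≤ (e ^ n) (*-monoˡ-≤ (h ^ suc n) (b≤pdw n)) ⟩
        pdw E n * h ^ suc n * e ^ n
      ≤⟨ *-monoˡ-≤ (e ^ n) (proj₁ (pdw-upper g h 2h²≤g² n)) ⟩
        g * (g + h) ^ n * e ^ n
      ≡⟨ trans (*-assoc g _ _) (cong (g *_) (sym (^-distribʳ-* (g + h) e n))) ⟩
        g * ((g + h) * e) ^ n
      <⟨ beat n n₀≤n ⟩
        ((e + h₀) * h) ^ n
      ≡⟨ ^-distribʳ-* (e + h₀) h n ⟩
        (e + h₀) ^ n * h ^ n
      ≤⟨ *-monoʳ-≤ ((e + h₀) ^ n) (m≤n*m (h ^ n) h {{>-nonZero 1≤h}}) ⟩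
        (e + h₀) ^ n * h ^ suc n
      ∎)
    where
    open ≤-Reasoning
    swap : ∀ x y z → x * y * z ≡ x * z * y
    swap = solve-∀

open import Data.Integer as ℤ using (+_; -[1+_])
import Data.Integer.Properties as ℤ
open import Data.Integer.Tactic.RingSolver as ℤ using ()
open import Data.Nat as ℕ using (ℕ; zero; suc; _≥_)
import Data.Nat.Properties as ℕ
open import Data.Nat.Coprimality using (Coprime)
open import Data.Product using (Σ; ∃; _×_; _,_)
open import Data.Rational as ℚ using (ℚ; mkℚ; 0ℚ; 1ℚ; _+_; _*_; _-_; -_; _≤_; _<_; toℚᵘ; *≤*; *<*; NonNegative)
import Data.Rational.Properties as ℚ
open import Data.Rational.Solver using (module +-*-Solver)
import Data.Rational.Unnormalised as ℚᵘ
import Data.Rational.Unnormalised.Properties as ℚᵘ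
open import Data.Sum using (inj₁; inj₂)
open import Relation.Binary.PropositionalEquality
open +-*-Solver
open Counting using (b-lower-bound; b-upper-bound)

toℚᵘ-ℕtoℚ : ∀ n → toℚᵘ (ℕtoℚ n) ℚᵘ.≃ ℚᵘ.mkℚᵘ (+ n) 0
toℚᵘ-ℕtoℚ n = ℚ.toℚᵘ-fromℚᵘ (ℚᵘ.mkℚᵘ (+ n) 0)

ℕtoℚ-+ : ∀ m n → ℕtoℚ (m ℕ.+ n) ≡ ℕtoℚ m + ℕtoℚ n
ℕtoℚ-+ m n = ℚ.toℚᵘ-injective (begin
    toℚᵘ (ℕtoℚ (m ℕ.+ n))
  ≈⟨ toℚᵘ-ℕtoℚ (m ℕ.+ n) ⟩
    ℚᵘ.mkℚᵘ (+ (m ℕ.+ n)) 0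
  ≈⟨ ℚᵘ.*≡* (trans (cong (ℤ._* + 1) (ℤ.pos-+ m n)) (e (+ m) (+ n))) ⟩
    ℚᵘ.mkℚᵘ (+ m) 0 ℚᵘ.+ ℚᵘ.mkℚᵘ (+ n) 0
  ≈⟨ ℚᵘ.+-cong (toℚᵘ-ℕtoℚ m) (toℚᵘ-ℕtoℚ n) ⟨
    toℚᵘ (ℕtoℚ m) ℚᵘ.+ toℚᵘ (ℕtoℚ n)
  ≈⟨ ℚ.toℚᵘ-homo-+ (ℕtoℚ m) (ℕtoℚ n) ⟨
    toℚᵘ (ℕtoℚ m + ℕtoℚ n)
  ∎)
  where
  open ℚᵘ.≃-Reasoning
  e : ∀ x y → (x ℤ.+ y) ℤ.* + 1 ≡ (x ℤ.* + 1 ℤ.+ y ℤ.* + 1) ℤ.* + 1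
  e = ℤ.solve-∀

ℕtoℚ-* : ∀ m n → ℕtoℚ (m ℕ.* n) ≡ ℕtoℚ m * ℕtoℚ n
ℕtoℚ-* m n = ℚ.toℚᵘ-injective (begin
    toℚᵘ (ℕtoℚ (m ℕ.* n))
  ≈⟨ toℚᵘ-ℕtoℚ (m ℕ.* n) ⟩
    ℚᵘ.mkℚᵘ (+ (m ℕ.* n)) 0
  ≈⟨ ℚᵘ.*≡* (cong (ℤ._* + 1) (ℤ.pos-* m n)) ⟩
    ℚᵘ.mkℚᵘ (+ m) 0 ℚᵘ.* ℚᵘ.mkℚᵘ (+ n) 0
  ≈⟨ ℚᵘ.*-cong (toℚᵘ-ℕtoℚ m) (toℚᵘ-ℕtoℚ n) ⟨
    toℚᵘ (ℕtoℚ m) ℚᵘ.* toℚᵘ (ℕtoℚ n)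
  ≈⟨ ℚ.toℚᵘ-homo-* (ℕtoℚ m) (ℕtoℚ n) ⟨
    toℚᵘ (ℕtoℚ m * ℕtoℚ n)
  ∎)
  where open ℚᵘ.≃-Reasoning

ℕtoℚ-^ : ∀ m n → ℕtoℚ (m ℕ.^ n) ≡ ℕtoℚ m ^ℚ n
ℕtoℚ-^ m zero    = refl
ℕtoℚ-^ m (suc n) = trans (ℕtoℚ-* m (m ℕ.^ n)) (cong (ℕtoℚ m *_) (ℕtoℚ-^ m n))

ℕtoℚ-mono-< : ∀ {m n} → m ℕ.< n → ℕtoℚ m < ℕtoℚ n
ℕtoℚ-mono-< {m} {n} m<n = ℚ.toℚᵘ-cancel-<
  (ℚᵘ.<-respˡ-≃ (ℚᵘ.≃-sym (toℚᵘ-ℕtoℚ m)) (ℚᵘ.<-respʳ-≃ (ℚᵘ.≃-sym (toℚᵘ-ℕtoℚ n))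
    (ℚᵘ.*<* (subst₂ ℤ._<_ (sym (ℤ.*-identityʳ (+ m))) (sym (ℤ.*-identityʳ (+ n))) (ℤ.+<+ m<n)))))

ℕtoℚ-cancel-< : ∀ {m n} → ℕtoℚ m < ℕtoℚ n → m ℕ.< n
ℕtoℚ-cancel-< {m} {n} m<n
  with ℚᵘ.<-respˡ-≃ (toℚᵘ-ℕtoℚ m) (ℚᵘ.<-respʳ-≃ (toℚᵘ-ℕtoℚ n) (ℚ.toℚᵘ-mono-< m<n))
... | ℚᵘ.*<* m·1<n·1 = ℤ.drop‿+<+ (subst₂ ℤ._<_ (ℤ.*-identityʳ (+ m)) (ℤ.*-identityʳ (+ n)) m·1<n·1)

ℕtoℚ-nonNeg : ∀ n → NonNegative (ℕtoℚ n)
ℕtoℚ-nonNeg n = ℚ.normalize-nonNeg n 1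

ℕtoℚ-square-pos : ∀ k → ℚ.Positive (ℕtoℚ (suc k) * ℕtoℚ (suc k))
ℕtoℚ-square-pos k = subst ℚ.Positive (ℕtoℚ-* (suc k) (suc k)) (ℚ.normalize-pos (suc k ℕ.* suc k) 1)

*-denominator : ∀ a d-1 .(c : Coprime a (suc d-1)) → mkℚ (+ a) d-1 c * ℕtoℚ (suc d-1) ≡ ℕtoℚ a
*-denominator a d-1 c = ℚ.toℚᵘ-injective (begin
    toℚᵘ (p * ℕtoℚ d)
  ≈⟨ ℚ.toℚᵘ-homo-* p (ℕtoℚ d) ⟩
    ℚᵘ.mkℚᵘ (+ a) d-1 ℚᵘ.* toℚᵘ (ℕtoℚ d)
  ≈⟨ ℚᵘ.*-congˡ {ℚᵘ.mkℚᵘ (+ a) d-1} (toℚᵘ-ℕtoℚ d) ⟩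
    ℚᵘ.mkℚᵘ (+ a) d-1 ℚᵘ.* ℚᵘ.mkℚᵘ (+ d) 0
  ≈⟨ ℚᵘ.*≡* (trans (ℤ.*-identityʳ (+ a ℤ.* + d)) (cong (λ z → + a ℤ.* + z) (sym (ℕ.*-identityʳ d)))) ⟩
    ℚᵘ.mkℚᵘ (+ a) 0
  ≈⟨ toℚᵘ-ℕtoℚ a ⟨
    toℚᵘ (ℕtoℚ a)
  ∎)
  where
  open ℚᵘ.≃-Reasoning
  p = mkℚ (+ a) d-1 c
  d = suc d-1

^ℚ-distrib-* : ∀ p q n → (p * q) ^ℚ n ≡ p ^ℚ n * q ^ℚ n
^ℚ-distrib-* p q zero    = refl
^ℚ-distrib-* p q (suc n) = trans (cong (p * q *_) (^ℚ-distrib-* p q n))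
  (solve 4 (λ p q x y → p :* q :* (x :* y) := p :* x :* (q :* y)) refl p q (p ^ℚ n) (q ^ℚ n))

scaled-^ : ∀ {p a d} n → p * ℕtoℚ d ≡ ℕtoℚ a → p ^ℚ n * ℕtoℚ (d ℕ.^ n) ≡ ℕtoℚ (a ℕ.^ n)
scaled-^ {p} {a} {d} n p·d≡a = begin
    p ^ℚ n * ℕtoℚ (d ℕ.^ n)
  ≡⟨ cong (p ^ℚ n *_) (ℕtoℚ-^ d n) ⟩
    p ^ℚ n * ℕtoℚ d ^ℚ n
  ≡⟨ ^ℚ-distrib-* p (ℕtoℚ d) n ⟨
    (p * ℕtoℚ d) ^ℚ n
  ≡⟨ cong (_^ℚ n) p·d≡a ⟩
    ℕtoℚ a ^ℚ n
  ≡⟨ ℕtoℚ-^ a n ⟨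
    ℕtoℚ (a ℕ.^ n)
  ∎
  where open ≡-Reasoning

power<count : ∀ {p a d} m n → p * ℕtoℚ d ≡ ℕtoℚ a → a ℕ.^ n ℕ.< m ℕ.* d ℕ.^ n → p ^ℚ n < ℕtoℚ m
power<count {d = d} m n p·d≡a a^n< = ℚ.*-cancelʳ-<-nonNeg (ℕtoℚ (d ℕ.^ n)) {{ℕtoℚ-nonNeg (d ℕ.^ n)}}
  (subst₂ _<_ (sym (scaled-^ n p·d≡a)) (ℕtoℚ-* m (d ℕ.^ n)) (ℕtoℚ-mono-< a^n<))

count<power : ∀ {q c e} m n → q * ℕtoℚ e ≡ ℕtoℚ c → m ℕ.* e ℕ.^ n ℕ.< c ℕ.^ n → ℕtoℚ m < q ^ℚ n
count<power {e = e} m n q·e≡c m·e^n< = ℚ.*-cancelʳ-<-nonNeg (ℕtoℚ (e ℕ.^ n)) {{ℕtoℚ-nonNeg (e ℕ.^ n)}}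
  (subst₂ _<_ (ℕtoℚ-* m (e ℕ.^ n)) (sym (scaled-^ n q·e≡c)) (ℕtoℚ-mono-< m·e^n<))

two : ℕtoℚ 2 ≡ 1ℚ + 1ℚ
two = ℕtoℚ-+ 1 1

below-1+√2 : ∀ p → 0ℚ ≤ p → BelowL p → p * p < (1ℚ + 1ℚ) * p + 1ℚ
below-1+√2 p 0≤p (inj₁ p<1) = ℚ.≤-<-trans p²≤p p<2p+1
  where
  p²≤p : p * p ≤ p
  p²≤p = subst (p * p ≤_) (ℚ.*-identityʳ p) (ℚ.*-monoˡ-≤-nonNeg p {{ℚ.nonNegative 0≤p}} (ℚ.<⇒≤ p<1))
  p<2p+1 : p < (1ℚ + 1ℚ) * p + 1ℚ
  p<2p+1 = subst₂ _<_ (ℚ.+-identityʳ p)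
    (solve 1 (λ p → p :+ (p :+ con 1ℚ) := (con 1ℚ :+ con 1ℚ) :* p :+ con 1ℚ) refl p)
    (ℚ.+-monoʳ-< p (subst (_< p + 1ℚ) (ℚ.+-identityʳ 0ℚ) (ℚ.+-mono-≤-< 0≤p 0<1)))
    where
    0<1 : 0ℚ < 1ℚ
    0<1 = *<* (ℤ.+<+ (ℕ.s≤s ℕ.z≤n))
below-1+√2 p 0≤p (inj₂ [p-1]²<2) = subst₂ _<_
  (solve 1 (λ p → (p :- con 1ℚ) :* (p :- con 1ℚ) :+ (con 1ℚ :+ con 1ℚ) :* p :+ :- con 1ℚ := p :* p) refl p)
  (solve 1 (λ p → (con 1ℚ :+ con 1ℚ) :+ (con 1ℚ :+ con 1ℚ) :* p :+ :- con 1ℚ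
                  := (con 1ℚ :+ con 1ℚ) :* p :+ con 1ℚ) refl p)
  (ℚ.+-monoˡ-< (- 1ℚ) (ℚ.+-monoˡ-< ((1ℚ + 1ℚ) * p) [p-1]²<2))

eventually-p^n<b : ∀ p → 0ℚ ≤ p → BelowL p → ∃ λ n₀ → ∀ n → n ≥ n₀ → p ^ℚ n < ℕtoℚ (b n)
eventually-p^n<b (mkℚ -[1+ _ ] _ _) (*≤* ())
eventually-p^n<b p@(mkℚ (+ a) d-1 c) 0≤p below =
  let n₀ , bound = b-lower-bound a d (ℕ.s≤s ℕ.z≤n) a²<2ad+d²
  in n₀ , λ n n≥n₀ → power<count (b n) n p·d≡a (bound n n≥n₀)
  where
  d = suc d-1
  dℚ = ℕtoℚ d
  aℚ = ℕtoℚ a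
  p·d≡a : p * dℚ ≡ aℚ
  p·d≡a = *-denominator a d-1 c
  a²<2ad+d² : a ℕ.* a ℕ.< 2 ℕ.* a ℕ.* d ℕ.+ d ℕ.* d
  a²<2ad+d² = ℕtoℚ-cancel-< (begin-strict
      ℕtoℚ (a ℕ.* a)
    ≡⟨ ℕtoℚ-* a a ⟩
      aℚ * aℚ
    ≡⟨ cong₂ _*_ p·d≡a p·d≡a ⟨
      (p * dℚ) * (p * dℚ)
    ≡⟨ solve 2 (λ p x → (p :* x) :* (p :* x) := (p :* p) :* (x :* x)) refl p dℚ ⟩
      (p * p) * (dℚ * dℚ)
    <⟨ ℚ.*-monoˡ-<-pos (dℚ * dℚ) {{ℕtoℚ-square-pos d-1}} (below-1+√2 p 0≤p below) ⟩
      ((1ℚ + 1ℚ) * p + 1ℚ) * (dℚ * dℚ)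
    ≡⟨ solve 2 (λ p x → ((con 1ℚ :+ con 1ℚ) :* p :+ con 1ℚ) :* (x :* x)
                      := (con 1ℚ :+ con 1ℚ) :* (p :* x) :* x :+ x :* x) refl p dℚ ⟩
      (1ℚ + 1ℚ) * (p * dℚ) * dℚ + dℚ * dℚ
    ≡⟨ cong₂ (λ x y → x * y * dℚ + dℚ * dℚ) (sym two) p·d≡a ⟩
      ℕtoℚ 2 * aℚ * dℚ + dℚ * dℚ
    ≡⟨ cong₂ _+_ (trans (ℕtoℚ-* (2 ℕ.* a) d) (cong (_* dℚ) (ℕtoℚ-* 2 a))) (ℕtoℚ-* d d) ⟨
      ℕtoℚ (2 ℕ.* a ℕ.* d) + ℕtoℚ (d ℕ.* d)
    ≡⟨ ℕtoℚ-+ (2 ℕ.* a ℕ.* d) (d ℕ.* d) ⟨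
      ℕtoℚ (2 ℕ.* a ℕ.* d ℕ.+ d ℕ.* d)
    ∎)
    where open ℚ.≤-Reasoning

eventually-b<q^n : ∀ q → AboveL q → ∃ λ n₀ → ∀ n → n ≥ n₀ → ℕtoℚ (b n) < q ^ℚ n
eventually-b<q^n (mkℚ -[1+ _ ] _ _) (*<* () , _)
eventually-b<q^n q@(mkℚ (+ c) e-1 c′) (1<q , 2<[q-1]²) =
  let n₀ , bound = b-upper-bound e h (ℕ.s≤s ℕ.z≤n) 2e²<h²
  in n₀ , λ n n≥n₀ → count<power (b n) n q·e≡c
            (subst (λ c → b n ℕ.* e ℕ.^ n ℕ.< c ℕ.^ n) e+h≡c (bound n n≥n₀))
  where
  e = suc e-1
  eℚ = ℕtoℚ e
  q·e≡c : q * eℚ ≡ ℕtoℚ c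
  q·e≡c = *-denominator c e-1 c′
  e<c : e ℕ.< c
  e<c = ℕtoℚ-cancel-< (subst₂ _<_ (ℚ.*-identityˡ eℚ) q·e≡c (ℚ.*-monoˡ-<-pos eℚ {{ℚ.normalize-pos e 1}} 1<q))
  h = c ℕ.∸ e
  e+h≡c : e ℕ.+ h ≡ c
  e+h≡c = ℕ.m+[n∸m]≡n (ℕ.<⇒≤ e<c)
  hℚ = ℕtoℚ h
  2e²<h² : 2 ℕ.* e ℕ.* e ℕ.< h ℕ.* h
  2e²<h² = ℕtoℚ-cancel-< (begin-strict
      ℕtoℚ (2 ℕ.* e ℕ.* e)
    ≡⟨ trans (ℕtoℚ-* (2 ℕ.* e) e) (cong (_* eℚ) (trans (ℕtoℚ-* 2 e) (cong (_* eℚ) two))) ⟩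
      (1ℚ + 1ℚ) * eℚ * eℚ
    ≡⟨ ℚ.*-assoc (1ℚ + 1ℚ) eℚ eℚ ⟩
      (1ℚ + 1ℚ) * (eℚ * eℚ)
    <⟨ ℚ.*-monoˡ-<-pos (eℚ * eℚ) {{ℕtoℚ-square-pos e-1}} 2<[q-1]² ⟩
      ((q - 1ℚ) * (q - 1ℚ)) * (eℚ * eℚ)
    ≡⟨ solve 2 (λ q x → ((q :- con 1ℚ) :* (q :- con 1ℚ)) :* (x :* x)
                      := (q :* x :- x) :* (q :* x :- x)) refl q eℚ ⟩
      (q * eℚ - eℚ) * (q * eℚ - eℚ)
    ≡⟨ cong (λ x → (x - eℚ) * (x - eℚ)) (trans q·e≡c (trans (cong ℕtoℚ (sym e+h≡c)) (ℕtoℚ-+ e h))) ⟩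
      (eℚ + hℚ - eℚ) * (eℚ + hℚ - eℚ)
    ≡⟨ solve 2 (λ x y → (x :+ y :- x) :* (x :+ y :- x) := y :* y) refl eℚ hℚ ⟩
      hℚ * hℚ
    ≡⟨ ℕtoℚ-* h h ⟨
      ℕtoℚ (h ℕ.* h)
    ∎)
    where open ℚ.≤-Reasoning

mainTheorem1 : (p q : ℚ) → 0ℚ ≤ p → BelowL p → AboveL q →
    Σ ℕ (λ N → (n : ℕ) → n ≥ N → (p ^ℚ n < ℕtoℚ (b n)) × (ℕtoℚ (b n) < q ^ℚ n))
mainTheorem1 p q 0≤p below above =
  let N₁ , lower = eventually-p^n<b p 0≤p below
      N₂ , upper = eventually-b<q^n q above
  in N₁ ℕ.⊔ N₂ , λ n n≥N →
       lower n (ℕ.≤-trans (ℕ.m≤m⊔n N₁ N₂) n≥N) , upper n (ℕ.≤-trans (ℕ.m≤n⊔m N₁ N₂) n≥N)
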